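{- Let $n\ge 5$ be odd and not divisible by $3$, let $G=\Gamma(\mathbb{Z}_n,\{1,2\cdot 3^{ -1}\})$, and let $H=\Gamma(\mathbb{Z}_n,\{a,b\})$ be any directed circulant graph with a two-element generating set $\{a,b\}$. Then $F_3(G)\ge F_3(H)$.
   Context: $3^{ -1}$ denotes the multiplicative inverse of $3$ modulo $n$. For a generating set $S$ of $(\mathbb{Z}_n,+)$ with $0\notin S$, $\Gamma(\mathbb{Z}_n,S)$ has vertices $v_0,\dots,v_{n-1}$ and an arc $v_j\to v_i$ iff $i-j\pmod n\in S$. For a digraph $D$ on $n$ vertices and $0\le i\le n-1$, $F_i(D)$ is the number of $i$-element vertex subsets $X$ such that the subdigraph induced by $V(D)\setminus X$ is strongly connected (a single vertex counts as strongly connected); these are the coefficients in $\mathrm{Rel}(D,p)=\sum_{i=0}^{n-1}F_i(D)p^{n-i}(1-p)^i$. -}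

module Defs where

open import Data.Nat using (ℕ; zero; suc; _+_; _*_; _∸_; NonZero)
open import Data.Nat.DivMod using (_%_; _mod_)
open import Data.Fin using (Fin; toℕ)
open import Data.Fin.Subset using (Subset; _∈_; _∉_; ∣_∣)
open import Data.List using (List; length)
open import Data.List.Relation.Unary.Unique.Propositional using (Unique)
import Data.List.Membership.Propositional as LM
open import Data.Product using (Σ; ∃; ∃-syntax; _×_; _,_)
open import Data.Sum using (_⊎_)
open import Relation.Binary.PropositionalEquality using (_≡_)
open import Function.Bundles using (_⇔_)

-- A digraph on vertex set Fin n: Arc j i means an arc j → i.
Digraph : ℕ → Set₁
Digraph n = Fin n → Fin n → Set

-- {a , b} generates (ℤ_n , +): every element is a (non-negative) integer
-- combination k·a + l·b modulo n (in a finite group the subgroup generated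
-- by a set is the set of such combinations).
Generates : (n : ℕ) .{{_ : NonZero n}} → Fin n → Fin n → Set
Generates n a b = ∀ (x : Fin n) → ∃[ k ] ∃[ l ] ((k * toℕ a + l * toℕ b) % n ≡ toℕ x)

-- Directed circulant Γ(ℤ_n, {a , b}): arc v_j → v_i iff (i - j) mod n ∈ {a , b}.
Circ : (n : ℕ) .{{_ : NonZero n}} → Fin n → Fin n → Digraph n
Circ n a b j i =
  ((toℕ i + (n ∸ toℕ j)) % n ≡ toℕ a) ⊎ ((toℕ i + (n ∸ toℕ j)) % n ≡ toℕ b)

data Reach {n : ℕ} (D : Digraph n) (X : Subset n) (u : Fin n) : Fin n → Set where
  here : Reach D X u u
  step : ∀ {w v} → Reach D X u w → D w v → v ∉ X → Reach D X u v

StronglyConnectedMinus : {n : ℕ} → Digraph n → Subset n → Set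
StronglyConnectedMinus D X = ∀ u v → u ∉ X → v ∉ X → Reach D X u v

-- IsF i D k : F_i(D) = k, i.e. the number of i-element vertex subsets X
-- whose removal leaves a strongly connected induced subdigraph equals k
-- (witnessed by a duplicate-free list enumerating exactly those subsets).
IsF : {n : ℕ} → ℕ → Digraph n → ℕ → Set
IsF {n} i D k =
  Σ (List (Subset n)) λ xs →
    Unique xs
    × (∀ (X : Subset n) → (X LM.∈ xs) ⇔ ((∣ X ∣ ≡ i) × StronglyConnectedMinus D X))
    × (length xs ≡ k)

-- With c = 3⁻¹ (mod n), G − X is strongly connected for every 3-set X that
-- contains no pair {w, w + c}.  The other 3-sets all have the form
-- {u, u + c, u + s} with s ∉ {0, c, −c}, so at most n(n − 3) of them are bad
-- for G.  For H one exhibits n(n − 3) distinct 3-sets whose removal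
-- disconnects H: the sets {u, u + d, u + s} with d = b − a when a + b ≠ 0, and
-- a variant with d = 2a when b = −a (this needs n ≥ 7).  Hence
-- F₃(H) + n(n − 3) ≤ C(n, 3) ≤ F₃(G) + n(n − 3).  For n = 5 every 3-set is
-- the complement of a pair, and F₃(H) ≤ 5 ≤ F₃(G) directly.

module Submission where

open import Defs
open import Data.Nat using (ℕ; zero; suc; _+_; _*_; _∸_; _≤_; _<_; NonZero; >-nonZero⁻¹; z≤n; s≤s)
open import Data.Nat.Properties
open import Data.Nat.DivMod
open import Data.Nat.Divisibility using (_∣_)
open import Data.Nat.Tactic.RingSolver using (solve-∀)
open import Algebra.Properties.CommutativeSemigroup +-commutativeSemigroup using (x∙yz≈y∙xz)
open import Data.Fin using (Fin; toℕ; zero; suc)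
open import Data.Fin.Properties using (toℕ-injective; toℕ<n; toℕ-fromℕ<)
open import Data.List using (List; []; _∷_; _++_; length; map; filter; cartesianProduct; allFin)
open import Data.List.Properties using (length-++; length-map; length-tabulate)
open import Data.List.Membership.Propositional using () renaming (_∈_ to _∈ₗ_)
open import Data.List.Membership.Propositional.Properties
open import Data.List.Relation.Binary.Subset.Propositional using (_⊆_)
open import Data.List.Relation.Unary.Any using (here; there)
import Data.List.Relation.Unary.All as All
open import Data.List.Relation.Unary.All using ([]; _∷_)
open import Data.List.Relation.Unary.AllPairs using ([]; _∷_)
open import Data.List.Relation.Unary.Unique.Propositional using (Unique)
open import Data.Product using (Σ-syntax; ∃-syntax; _×_; _,_; proj₁; proj₂; uncurry)
open import Data.Empty using (⊥; ⊥-elim)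
open import Data.List.Relation.Unary.Unique.Propositional.Properties as Unique using ()
open import Data.Fin.Subset using (Subset; _∈_; _∉_; ∣_∣; _∪_; _─_; _-_; ⁅_⁆; ∁; Nonempty) renaming (_⊆_ to _⊆ₛ_)
open import Data.Fin.Subset.Properties
open import Data.Fin.Properties using (any?) renaming (_≟_ to _≟ᶠ_)
open import Data.Bool using (true; false)
open import Data.Bool.Properties using (not-involutive)
open import Data.Vec.Base using ([]; _∷_; here; there)
open import Function.Bundles using (Equivalence)
open import Function.Base using (_∘_)
open import Data.Sum using (_⊎_; inj₁; inj₂)
open import Relation.Binary.PropositionalEquality
open import Relation.Nullary using (¬_; ¬?; Dec; yes; no)
open import Relation.Nullary.Decidable using (_×-dec_; True; False; toWitness; toWitnessFalse)

-- Arithmetic modulo n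

module Modular (n : ℕ) {{_ : NonZero n}} where

  infix 4 _≈_
  _≈_ : ℕ → ℕ → Set
  x ≈ y = x % n ≡ y % n

  %-≈ : ∀ x → x % n ≈ x
  %-≈ x = m%n%n≡m%n x n

  +-≈ : ∀ {a b c d} → a ≈ b → c ≈ d → a + c ≈ b + d
  +-≈ {a} {b} {c} {d} p q = begin
    (a + c) % n          ≡⟨ %-distribˡ-+ a c n ⟩
    (a % n + c % n) % n  ≡⟨ cong₂ (λ u v → (u + v) % n) p q ⟩
    (b % n + d % n) % n  ≡⟨ %-distribˡ-+ b d n ⟨
    (b + d) % n          ∎
    where open ≡-Reasoning

  *-≈ : ∀ k {a b} → a ≈ b → k * a ≈ k * b
  *-≈ k {a} {b} p = begin
    (k * a) % n              ≡⟨ %-distribˡ-* k a n ⟩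
    (k % n * (a % n)) % n    ≡⟨ cong (λ u → (k % n * u) % n) p ⟩
    (k % n * (b % n)) % n    ≡⟨ %-distribˡ-* k b n ⟨
    (k * b) % n              ∎
    where open ≡-Reasoning

  ≈⇒≡ : ∀ {x y} → x < n → y < n → x ≈ y → x ≡ y
  ≈⇒≡ {x} {y} x<n y<n x≈y = trans (sym (m<n⇒m%n≡m x<n)) (trans x≈y (m<n⇒m%n≡m y<n))

  0<n : 0 < n
  0<n = >-nonZero⁻¹ n

  n≈0 : n ≈ 0
  n≈0 = trans (n%n≡0 n) (sym (m<n⇒m%n≡m 0<n))

  x+n≈x : ∀ x → x + n ≈ x
  x+n≈x x = [m+n]%n≡m%n x n

  ≢0⇒≉0 : ∀ {x} → x < n → x ≢ 0 → ¬ x ≈ 0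
  ≢0⇒≉0 x<n x≢0 x≈0 = x≢0 (≈⇒≡ x<n 0<n x≈0)

  -- the additive inverse, as a representative in [1, n]
  neg : ℕ → ℕ
  neg x = n ∸ x % n

  neg-inverseˡ : ∀ x → neg x + x ≈ 0
  neg-inverseˡ x = trans (+-≈ {neg x} refl (sym (%-≈ x)))
    (trans (cong (_% n) (m∸n+n≡m (<⇒≤ (m%n<n x n)))) n≈0)

  neg-inverseʳ : ∀ x → x + neg x ≈ 0
  neg-inverseʳ x = trans (cong (_% n) (+-comm x (neg x))) (neg-inverseˡ x)

  neg≈0⇒≈0 : ∀ {x} → neg x ≈ 0 → x ≈ 0
  neg≈0⇒≈0 {x} e = trans (cong (_% n) (sym (+-identityʳ x))) (trans (+-≈ {x} refl (sym e)) (neg-inverseʳ x))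

  +-cancelˡ-≈ : ∀ a {c d} → a + c ≈ a + d → c ≈ d
  +-cancelˡ-≈ a {c} {d} p = trans (sym (cancel c)) (trans (+-≈ {neg a} refl p) (cancel d))
    where
    cancel : ∀ e → neg a + (a + e) ≈ e
    cancel e = trans (cong (_% n) (sym (+-assoc (neg a) a e))) (+-≈ {neg a + a} {0} {e} (neg-inverseˡ a) refl)

  x+y≈x⇒y≈0 : ∀ a {c} → a + c ≈ a → c ≈ 0
  x+y≈x⇒y≈0 a {c} e = +-cancelˡ-≈ a (trans e (cong (_% n) (sym (+-identityʳ a))))

  +-≈0⇒≈neg : ∀ d {x} → d + x ≈ 0 → x ≈ neg d
  +-≈0⇒≈neg d e = +-cancelˡ-≈ d (trans e (sym (neg-inverseʳ d)))

  ≈neg⇒+-≈0 : ∀ d {x} → x ≈ neg d → d + x ≈ 0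
  ≈neg⇒+-≈0 d e = trans (+-≈ {d} refl e) (neg-inverseʳ d)

  -- n odd: (n + 1)/2 is the inverse of 2
  x+x≈0⇒x≈0 : n % 2 ≡ 1 → ∀ x → x + x ≈ 0 → x ≈ 0
  x+x≈0⇒x≈0 odd x x+x≈0 = begin
    x % n                         ≡⟨ [m+kn]%n≡m%n x x n ⟨
    (x + x * n) % n               ≡⟨ cong (λ m → (x + x * m) % n) n≡1+h*2 ⟩
    (x + x * (1 + h * 2)) % n     ≡⟨ cong (_% n) (x+x[1+2h]≡[1+h][x+x] x h) ⟩
    (suc h * (x + x)) % n         ≡⟨ *-≈ (suc h) x+x≈0 ⟩
    (suc h * 0) % n               ≡⟨ cong (_% n) (*-zeroʳ (suc h)) ⟩
    0 % n                         ∎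
    where
    open ≡-Reasoning
    h = n / 2
    n≡1+h*2 : n ≡ 1 + h * 2
    n≡1+h*2 = trans (m≡m%n+[m/n]*n n 2) (cong (_+ h * 2) odd)
    x+x[1+2h]≡[1+h][x+x] : ∀ x h → x + x * (1 + h * 2) ≡ suc h * (x + x)
    x+x[1+2h]≡[1+h][x+x] = solve-∀

  infixl 6 _⊕_
  _⊕_ : Fin n → ℕ → Fin n
  v ⊕ k = (toℕ v + k) mod n

  toℕ-⊕ : ∀ v k → toℕ (v ⊕ k) ≈ toℕ v + k
  toℕ-⊕ v k = trans (cong (_% n) (toℕ-fromℕ< (m%n<n (toℕ v + k) n))) (%-≈ (toℕ v + k))

  toℕ-≈-injective : ∀ {u v : Fin n} → toℕ u ≈ toℕ v → u ≡ v
  toℕ-≈-injective {u} {v} p = toℕ-injective (≈⇒≡ (toℕ<n u) (toℕ<n v) p)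

  ⊕-cong : ∀ v {k k'} → k ≈ k' → v ⊕ k ≡ v ⊕ k'
  ⊕-cong v {k} {k'} p = toℕ-≈-injective (trans (toℕ-⊕ v k) (trans (+-≈ {toℕ v} refl p) (sym (toℕ-⊕ v k'))))

  ⊕-assoc : ∀ v i j → v ⊕ i ⊕ j ≡ v ⊕ (i + j)
  ⊕-assoc v i j = toℕ-≈-injective (begin
    toℕ (v ⊕ i ⊕ j) % n     ≡⟨ toℕ-⊕ (v ⊕ i) j ⟩
    (toℕ (v ⊕ i) + j) % n   ≡⟨ +-≈ (toℕ-⊕ v i) refl ⟩
    (toℕ v + i + j) % n     ≡⟨ cong (_% n) (+-assoc (toℕ v) i j) ⟩
    (toℕ v + (i + j)) % n   ≡⟨ toℕ-⊕ v (i + j) ⟨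
    toℕ (v ⊕ (i + j)) % n   ∎)
    where open ≡-Reasoning

  ⊕-identityʳ : ∀ v → v ⊕ 0 ≡ v
  ⊕-identityʳ v = toℕ-≈-injective (trans (toℕ-⊕ v 0) (cong (_% n) (+-identityʳ (toℕ v))))

  ⊕-cancelˡ : ∀ v {i j} → v ⊕ i ≡ v ⊕ j → i ≈ j
  ⊕-cancelˡ v {i} {j} e = +-cancelˡ-≈ (toℕ v) (trans (sym (toℕ-⊕ v i)) (trans (cong (λ w → toℕ w % n) e) (toℕ-⊕ v j)))

  ⊕-⊕neg : ∀ v k → v ⊕ k ⊕ neg k ≡ v
  ⊕-⊕neg v k = trans (⊕-assoc v k (neg k)) (trans (⊕-cong v (neg-inverseʳ k)) (⊕-identityʳ v))

  toℕ-mod : ∀ k → toℕ (k mod n) ≈ k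
  toℕ-mod k = trans (cong (_% n) (toℕ-fromℕ< (m%n<n k n))) (%-≈ k)

  mod-≡⇒≈ : ∀ {k l} → k mod n ≡ l mod n → k ≈ l
  mod-≡⇒≈ {k} {l} e = trans (sym (toℕ-mod k)) (trans (cong (λ v → toℕ v % n) e) (toℕ-mod l))

  ≈⇒≡-mod : ∀ {s : Fin n} {k} → toℕ s ≈ k → s ≡ k mod n
  ≈⇒≡-mod {s} {k} e = toℕ-≈-injective (trans e (sym (toℕ-mod k)))

  ≡-mod⇒≈ : ∀ {s : Fin n} {k} → s ≡ k mod n → toℕ s ≈ k
  ≡-mod⇒≈ refl = toℕ-mod _

  offset : Fin n → Fin n → ℕ
  offset u v = (toℕ v + (n ∸ toℕ u)) % n

  ⊕-offset : ∀ u v → u ⊕ offset u v ≡ v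
  ⊕-offset u v = toℕ-≈-injective (begin
    toℕ (u ⊕ offset u v) % n                ≡⟨ toℕ-⊕ u (offset u v) ⟩
    (toℕ u + offset u v) % n                ≡⟨ +-≈ {toℕ u} refl (%-≈ _) ⟩
    (toℕ u + (toℕ v + (n ∸ toℕ u))) % n     ≡⟨ cong (_% n) (x∙yz≈y∙xz (toℕ u) (toℕ v) (n ∸ toℕ u)) ⟩
    (toℕ v + (toℕ u + (n ∸ toℕ u))) % n     ≡⟨ cong (λ m → (toℕ v + m) % n) (m+[n∸m]≡n (<⇒≤ (toℕ<n u))) ⟩
    (toℕ v + n) % n                         ≡⟨ x+n≈x (toℕ v) ⟩
    toℕ v % n                               ∎)
    where open ≡-Reasoning

  ⊕-offset-mod : ∀ u v → u ⊕ toℕ (offset u v mod n) ≡ v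
  ⊕-offset-mod u v = trans (⊕-cong u (toℕ-mod _)) (⊕-offset u v)

  offset-⊕ : ∀ u k → offset u (u ⊕ k) ≡ k % n
  offset-⊕ u k = ≈⇒≡ (m%n<n _ n) (m%n<n k n)
    (trans (⊕-cancelˡ u (⊕-offset u (u ⊕ k))) (sym (%-≈ k)))

module _ (n : ℕ) {{_ : NonZero n}} where
  open Modular n

  Circ-arc⁻ : ∀ (a b : Fin n) {j i} → Circ n a b j i → i ≡ j ⊕ toℕ a ⊎ i ≡ j ⊕ toℕ b
  Circ-arc⁻ a b {j} {i} (inj₁ e) = inj₁ (trans (sym (⊕-offset j i)) (cong (j ⊕_) e))
  Circ-arc⁻ a b {j} {i} (inj₂ e) = inj₂ (trans (sym (⊕-offset j i)) (cong (j ⊕_) e))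

  Circ-arcˡ : ∀ (a b j : Fin n) → Circ n a b j (j ⊕ toℕ a)
  Circ-arcˡ a b j = inj₁ (trans (offset-⊕ j (toℕ a)) (m<n⇒m%n≡m (toℕ<n a)))

  Circ-arcʳ : ∀ (a b j : Fin n) → Circ n a b j (j ⊕ toℕ b)
  Circ-arcʳ a b j = inj₂ (trans (offset-⊕ j (toℕ b)) (m<n⇒m%n≡m (toℕ<n b)))

-- Duplicate-free lists and finite subsets

module _ {A : Set} where

  Unique-⊆⇒length≤ : ∀ {xs ys : List A} → Unique xs → xs ⊆ ys → length xs ≤ length ys
  Unique-⊆⇒length≤ {[]} _ _ = z≤n
  Unique-⊆⇒length≤ {x ∷ xs} {ys} (x∉xs ∷ u) xs⊆ys with ys₁ , ys₂ , refl ← ∈-∃++ (xs⊆ys (here refl)) =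
    begin
      suc (length xs)                     ≤⟨ s≤s (Unique-⊆⇒length≤ u xs⊆ys₁++ys₂) ⟩
      suc (length (ys₁ ++ ys₂))           ≡⟨ cong suc (length-++ ys₁) ⟩
      suc (length ys₁ + length ys₂)       ≡⟨ +-suc (length ys₁) (length ys₂) ⟨
      length ys₁ + length (x ∷ ys₂)       ≡⟨ length-++ ys₁ ⟨
      length (ys₁ ++ x ∷ ys₂)             ∎
    where
    open ≤-Reasoning
    xs⊆ys₁++ys₂ : xs ⊆ ys₁ ++ ys₂
    xs⊆ys₁++ys₂ {y} y∈xs with ∈-++⁻ ys₁ (xs⊆ys (there y∈xs))
    ... | inj₁ y∈ys₁ = ∈-++⁺ˡ y∈ys₁
    ... | inj₂ (here refl) = ⊥-elim (All.lookup x∉xs y∈xs refl)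
    ... | inj₂ (there y∈ys₂) = ∈-++⁺ʳ ys₁ y∈ys₂

  map⁺-Unique : ∀ {B : Set} (f : A → B) {xs : List A} → Unique xs →
    (∀ {x y} → x ∈ₗ xs → y ∈ₗ xs → f x ≡ f y → x ≡ y) → Unique (map f xs)
  map⁺-Unique f {[]} _ _ = []
  map⁺-Unique f {x ∷ xs} (x∉xs ∷ u) inj =
    All.tabulate fx∉ ∷ map⁺-Unique f u (λ p q → inj (there p) (there q))
    where
    fx∉ : ∀ {z} → z ∈ₗ map f xs → f x ≢ z
    fx∉ z∈ e with y , y∈xs , refl ← ∈-map⁻ f z∈ = All.lookup x∉xs y∈xs (inj (here refl) (there y∈xs) e)

length-cartesianProduct : ∀ {A B : Set} (xs : List A) (ys : List B) →
  length (cartesianProduct xs ys) ≡ length xs * length ys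
length-cartesianProduct [] ys = refl
length-cartesianProduct (x ∷ xs) ys = trans (length-++ (map (x ,_) ys))
  (cong₂ _+_ (length-map (x ,_) ys) (length-cartesianProduct xs ys))

x∈p─q⁻ : ∀ {n} {x : Fin n} (p q : Subset n) → x ∈ p ─ q → x ∈ p × x ∉ q
x∈p─q⁻ (true ∷ p) (false ∷ q) here = here , λ ()
x∈p─q⁻ {x = zero} (true ∷ p) (true ∷ q) ()
x∈p─q⁻ {x = zero} (false ∷ p) (true ∷ q) ()
x∈p─q⁻ {x = zero} (false ∷ p) (false ∷ q) ()
x∈p─q⁻ {x = suc x} (_ ∷ p) (_ ∷ q) (there x∈) =
  let x∈p , x∉q = x∈p─q⁻ p q x∈ in there x∈p , λ x∈q → x∉q (drop-there x∈q)

∣p∪q∣≤∣p∣+∣q∣ : ∀ {n} (p q : Subset n) → ∣ p ∪ q ∣ ≤ ∣ p ∣ + ∣ q ∣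
∣p∪q∣≤∣p∣+∣q∣ [] [] = z≤n
∣p∪q∣≤∣p∣+∣q∣ (true ∷ p) (true ∷ q) = s≤s (≤-trans (∣p∪q∣≤∣p∣+∣q∣ p q) (≤-trans (n≤1+n _) (≤-reflexive (sym (+-suc _ _)))))
∣p∪q∣≤∣p∣+∣q∣ (true ∷ p) (false ∷ q) = s≤s (∣p∪q∣≤∣p∣+∣q∣ p q)
∣p∪q∣≤∣p∣+∣q∣ (false ∷ p) (true ∷ q) = ≤-trans (s≤s (∣p∪q∣≤∣p∣+∣q∣ p q)) (≤-reflexive (sym (+-suc _ _)))
∣p∪q∣≤∣p∣+∣q∣ (false ∷ p) (false ∷ q) = ∣p∪q∣≤∣p∣+∣q∣ p q

∁-involutive : ∀ {n} (p : Subset n) → ∁ (∁ p) ≡ p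
∁-involutive [] = refl
∁-involutive (x ∷ p) = cong₂ _∷_ (not-involutive x) (∁-involutive p)

module _ {n : ℕ} where

  x∈p-y⁻ : ∀ {x y : Fin n} (p : Subset n) → x ∈ p - y → x ∈ p × x ≢ y
  x∈p-y⁻ {y = y} p x∈ = let x∈p , x∉y = x∈p─q⁻ p ⁅ y ⁆ x∈ in x∈p , x∉⁅y⁆⇒x≢y x∉y

  Unique⇒length≤∣_∣ : ∀ (p : Subset n) {ts : List (Fin n)} → Unique ts → (∀ {t} → t ∈ₗ ts → t ∈ p) → length ts ≤ ∣ p ∣
  Unique⇒length≤∣ p ∣ {[]} _ _ = z≤n
  Unique⇒length≤∣ p ∣ {t ∷ ts} (t∉ts ∷ u) ts⊆p =
    ≤-trans (s≤s (Unique⇒length≤∣ p - t ∣ u ts⊆p-t)) (x∈p⇒∣p-x∣<∣p∣ (ts⊆p (here refl)))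
    where
    ts⊆p-t : ∀ {s} → s ∈ₗ ts → s ∈ p - t
    ts⊆p-t s∈ = x∈p∧x≢y⇒x∈p-y (ts⊆p (there s∈)) (λ e → All.lookup t∉ts s∈ (sym e))

  ∣p∣≤1+∣p-x∣ : ∀ (p : Subset n) x → ∣ p ∣ ≤ suc ∣ p - x ∣
  ∣p∣≤1+∣p-x∣ p x = begin
    ∣ p ∣                     ≤⟨ p⊆q⇒∣p∣≤∣q∣ p⊆p-x∪x ⟩
    ∣ (p - x) ∪ ⁅ x ⁆ ∣       ≤⟨ ∣p∪q∣≤∣p∣+∣q∣ (p - x) ⁅ x ⁆ ⟩
    ∣ p - x ∣ + ∣ ⁅ x ⁆ ∣     ≡⟨ cong (∣ p - x ∣ +_) (∣⁅x⁆∣≡1 x) ⟩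
    ∣ p - x ∣ + 1             ≡⟨ +-comm _ 1 ⟩
    suc ∣ p - x ∣             ∎
    where
    open ≤-Reasoning
    p⊆p-x∪x : p ⊆ₛ (p - x) ∪ ⁅ x ⁆
    p⊆p-x∪x {t} t∈p with t ≟ᶠ x
    ... | yes refl = x∈p∪q⁺ (inj₂ (x∈⁅x⁆ t))
    ... | no t≢x = x∈p∪q⁺ (inj₁ (x∈p∧x≢y⇒x∈p-y t∈p t≢x))

  0<∣p∣⇒Nonempty : ∀ (p : Subset n) → 0 < ∣ p ∣ → Nonempty p
  0<∣p∣⇒Nonempty p 0<∣p∣ with nonempty? p
  ... | yes ne = ne
  ... | no ¬ne = ⊥-elim (<-irrefl (sym (trans (cong ∣_∣ (Empty-unique ¬ne)) (∣⊥∣≡0 n))) 0<∣p∣)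

  ∃-∈-≢ : ∀ (p : Subset n) → 2 ≤ ∣ p ∣ → ∀ x → ∃[ r ] r ∈ p × r ≢ x
  ∃-∈-≢ p 2≤∣p∣ x with 0<∣p∣⇒Nonempty (p - x) (≤-pred (≤-trans 2≤∣p∣ (∣p∣≤1+∣p-x∣ p x)))
  ... | r , r∈ = r , x∈p-y⁻ p r∈

  triple : Fin n → Fin n → Fin n → Subset n
  triple x y z = ⁅ x ⁆ ∪ (⁅ y ⁆ ∪ ⁅ z ⁆)

  ∈triple₁ : ∀ x y z → x ∈ triple x y z
  ∈triple₁ x y z = x∈p∪q⁺ (inj₁ (x∈⁅x⁆ x))

  ∈triple₂ : ∀ x y z → y ∈ triple x y z
  ∈triple₂ x y z = x∈p∪q⁺ (inj₂ (x∈p∪q⁺ (inj₁ (x∈⁅x⁆ y))))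

  ∈triple₃ : ∀ x y z → z ∈ triple x y z
  ∈triple₃ x y z = x∈p∪q⁺ (inj₂ (x∈p∪q⁺ (inj₂ (x∈⁅x⁆ z))))

  ∈triple⁻ : ∀ {t} x y z → t ∈ triple x y z → t ≡ x ⊎ t ≡ y ⊎ t ≡ z
  ∈triple⁻ x y z t∈ with x∈p∪q⁻ ⁅ x ⁆ _ t∈
  ... | inj₁ t∈x = inj₁ (x∈⁅y⁆⇒x≡y x t∈x)
  ... | inj₂ t∈yz with x∈p∪q⁻ ⁅ y ⁆ ⁅ z ⁆ t∈yz
  ... | inj₁ t∈y = inj₂ (inj₁ (x∈⁅y⁆⇒x≡y y t∈y))
  ... | inj₂ t∈z = inj₂ (inj₂ (x∈⁅y⁆⇒x≡y z t∈z))

  ∣triple∣≡3 : ∀ {x y z} → x ≢ y → x ≢ z → y ≢ z → ∣ triple x y z ∣ ≡ 3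
  ∣triple∣≡3 {x} {y} {z} x≢y x≢z y≢z = ≤-antisym ≤3
    (Unique⇒length≤∣ triple x y z ∣ ((x≢y ∷ x≢z ∷ []) ∷ (y≢z ∷ []) ∷ [] ∷ [])
      λ { (here refl) → ∈triple₁ x y z ; (there (here refl)) → ∈triple₂ x y z ; (there (there (here refl))) → ∈triple₃ x y z })
    where
    open ≤-Reasoning
    ≤3 : ∣ triple x y z ∣ ≤ 3
    ≤3 = begin
      ∣ triple x y z ∣                     ≤⟨ ∣p∪q∣≤∣p∣+∣q∣ ⁅ x ⁆ _ ⟩
      ∣ ⁅ x ⁆ ∣ + ∣ ⁅ y ⁆ ∪ ⁅ z ⁆ ∣         ≤⟨ +-monoʳ-≤ ∣ ⁅ x ⁆ ∣ (∣p∪q∣≤∣p∣+∣q∣ ⁅ y ⁆ ⁅ z ⁆) ⟩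
      ∣ ⁅ x ⁆ ∣ + (∣ ⁅ y ⁆ ∣ + ∣ ⁅ z ⁆ ∣)   ≡⟨ cong₂ _+_ (∣⁅x⁆∣≡1 x) (cong₂ _+_ (∣⁅x⁆∣≡1 y) (∣⁅x⁆∣≡1 z)) ⟩
      3                                    ∎

  triple-rotate : ∀ x y z → triple x y z ≡ triple z x y
  triple-rotate x y z = ⊆-antisym (λ t∈ → to (∈triple⁻ x y z t∈)) (λ t∈ → from (∈triple⁻ z x y t∈))
    where
    to : ∀ {t} → t ≡ x ⊎ t ≡ y ⊎ t ≡ z → t ∈ triple z x y
    to (inj₁ refl) = ∈triple₂ z x y
    to (inj₂ (inj₁ refl)) = ∈triple₃ z x y
    to (inj₂ (inj₂ refl)) = ∈triple₁ z x y
    from : ∀ {t} → t ≡ z ⊎ t ≡ x ⊎ t ≡ y → t ∈ triple x y z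
    from (inj₁ refl) = ∈triple₃ x y z
    from (inj₂ (inj₁ refl)) = ∈triple₁ x y z
    from (inj₂ (inj₂ refl)) = ∈triple₂ x y z

  ∣X∣≡3⇒triple : ∀ (X : Subset n) → ∣ X ∣ ≡ 3 → ∀ {x y} → x ∈ X → y ∈ X → x ≢ y →
    ∃[ z ] z ≢ x × z ≢ y × X ≡ triple x y z
  ∣X∣≡3⇒triple X ∣X∣≡3 {x} {y} x∈X y∈X x≢y with ∃-∈-≢ (X - x) 2≤∣X-x∣ y
    where
    2≤∣X-x∣ : 2 ≤ ∣ X - x ∣
    2≤∣X-x∣ = ≤-pred (subst (_≤ suc ∣ X - x ∣) ∣X∣≡3 (∣p∣≤1+∣p-x∣ X x))
  ... | z , z∈X-x , z≢y with z∈X , z≢x ← x∈p-y⁻ X z∈X-x =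
    z , z≢x , z≢y , ⊆-antisym X⊆triple (λ t∈ → triple⊆X (∈triple⁻ x y z t∈))
    where
    triple⊆X : ∀ {t} → t ≡ x ⊎ t ≡ y ⊎ t ≡ z → t ∈ X
    triple⊆X (inj₁ refl) = x∈X
    triple⊆X (inj₂ (inj₁ refl)) = y∈X
    triple⊆X (inj₂ (inj₂ refl)) = z∈X
    X⊆triple : X ⊆ₛ triple x y z
    X⊆triple {t} t∈X with t ≟ᶠ x | t ≟ᶠ y | t ≟ᶠ z
    ... | yes refl | _ | _ = ∈triple₁ x y z
    ... | no _ | yes refl | _ = ∈triple₂ x y z
    ... | no _ | no _ | yes refl = ∈triple₃ x y z
    ... | no t≢x | no t≢y | no t≢z = ⊥-elim (4≰3 (subst (4 ≤_) ∣X∣≡3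
      (Unique⇒length≤∣ X ∣ {t ∷ x ∷ y ∷ z ∷ []}
        ((t≢x ∷ t≢y ∷ t≢z ∷ []) ∷ (x≢y ∷ (λ e → z≢x (sym e)) ∷ []) ∷ ((λ e → z≢y (sym e)) ∷ []) ∷ [] ∷ [])
        λ { (here refl) → t∈X ; (there (here refl)) → x∈X ; (there (there (here refl))) → y∈X
          ; (there (there (there (here refl)))) → z∈X })))
      where
      4≰3 : ¬ (4 ≤ 3)
      4≰3 (s≤s (s≤s (s≤s ())))

  ∈pair⁻ : ∀ {t} (x y : Fin n) → t ∈ ⁅ x ⁆ ∪ ⁅ y ⁆ → t ≡ x ⊎ t ≡ y
  ∈pair⁻ x y t∈ with x∈p∪q⁻ ⁅ x ⁆ ⁅ y ⁆ t∈
  ... | inj₁ t∈x = inj₁ (x∈⁅y⁆⇒x≡y x t∈x)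
  ... | inj₂ t∈y = inj₂ (x∈⁅y⁆⇒x≡y y t∈y)

  ∣pair∣≡2 : ∀ {x y : Fin n} → x ≢ y → ∣ ⁅ x ⁆ ∪ ⁅ y ⁆ ∣ ≡ 2
  ∣pair∣≡2 {x} {y} x≢y = ≤-antisym
    (≤-trans (∣p∪q∣≤∣p∣+∣q∣ ⁅ x ⁆ ⁅ y ⁆) (≤-reflexive (cong₂ _+_ (∣⁅x⁆∣≡1 x) (∣⁅x⁆∣≡1 y))))
    (Unique⇒length≤∣ ⁅ x ⁆ ∪ ⁅ y ⁆ ∣ ((x≢y ∷ []) ∷ [] ∷ [])
      λ { (here refl) → x∈p∪q⁺ (inj₁ (x∈⁅x⁆ x)) ; (there (here refl)) → x∈p∪q⁺ (inj₂ (x∈⁅x⁆ y)) })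

  ∣P∣≡2⇒pair : ∀ (P : Subset n) → ∣ P ∣ ≡ 2 → ∃[ x ] ∃[ y ] x ≢ y × P ≡ ⁅ x ⁆ ∪ ⁅ y ⁆
  ∣P∣≡2⇒pair P ∣P∣≡2 with x , x∈P ← 0<∣p∣⇒Nonempty P (subst (0 <_) (sym ∣P∣≡2) (s≤s z≤n))
                      with y , y∈P , y≢x ← ∃-∈-≢ P (≤-reflexive (sym ∣P∣≡2)) x = x , y , (λ e → y≢x (sym e)) , ⊆-antisym P⊆pair pair⊆P
    where
    pair⊆P : ⁅ x ⁆ ∪ ⁅ y ⁆ ⊆ₛ P
    pair⊆P t∈ with ∈pair⁻ x y t∈
    ... | inj₁ refl = x∈P
    ... | inj₂ refl = y∈P
    P⊆pair : P ⊆ₛ ⁅ x ⁆ ∪ ⁅ y ⁆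
    P⊆pair {t} t∈P with t ≟ᶠ x | t ≟ᶠ y
    ... | yes refl | _ = x∈p∪q⁺ (inj₁ (x∈⁅x⁆ t))
    ... | no _ | yes refl = x∈p∪q⁺ (inj₂ (x∈⁅x⁆ t))
    ... | no t≢x | no t≢y = ⊥-elim (3≰2 (subst (3 ≤_) ∣P∣≡2
      (Unique⇒length≤∣ P ∣ {t ∷ x ∷ y ∷ []} ((t≢x ∷ t≢y ∷ []) ∷ ((λ e → y≢x (sym e)) ∷ []) ∷ [] ∷ [])
        λ { (here refl) → t∈P ; (there (here refl)) → x∈P ; (there (there (here refl))) → y∈P })))
      where
      3≰2 : ¬ (3 ≤ 2)
      3≰2 (s≤s (s≤s ()))

module _ {n : ℕ} {x y z : Fin n} (x≢y : x ≢ y) (x≢z : x ≢ z) (y≢z : y ≢ z) where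

  avoiding : List (Fin n)
  avoiding = filter (λ s → ¬? (s ∈? triple x y z)) (allFin n)

  ∈-avoiding⁺ : ∀ {s} → s ∉ triple x y z → s ∈ₗ avoiding
  ∈-avoiding⁺ {s} s∉ = ∈-filter⁺ (λ s → ¬? (s ∈? triple x y z)) (∈-allFin s) s∉

  ∈-avoiding⁻ : ∀ {s} → s ∈ₗ avoiding → s ∉ triple x y z
  ∈-avoiding⁻ s∈ = proj₂ (∈-filter⁻ (λ s → ¬? (s ∈? triple x y z)) {xs = allFin n} s∈)

  Unique-avoiding : Unique avoiding
  Unique-avoiding = Unique.filter⁺ (λ s → ¬? (s ∈? triple x y z)) (Unique.allFin⁺ n)

  length-avoiding : length avoiding ≡ n ∸ 3
  length-avoiding = trans (sym (m+n∸n≡m (length avoiding) 3)) (cong (_∸ 3) (≤-antisym ≤n n≤))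
    where
    open ≤-Reasoning
    xyz : List (Fin n)
    xyz = x ∷ y ∷ z ∷ []
    xyz⊆triple : ∀ {t} → t ∈ₗ xyz → t ∈ triple x y z
    xyz⊆triple (here refl) = ∈triple₁ x y z
    xyz⊆triple (there (here refl)) = ∈triple₂ x y z
    xyz⊆triple (there (there (here refl))) = ∈triple₃ x y z
    Unique-avoiding++xyz : Unique (avoiding ++ xyz)
    Unique-avoiding++xyz = Unique.++⁺ Unique-avoiding ((x≢y ∷ x≢z ∷ []) ∷ (y≢z ∷ []) ∷ [] ∷ [])
      λ (t∈avoiding , t∈xyz) → ∈-avoiding⁻ t∈avoiding (xyz⊆triple t∈xyz)
    allFin⊆avoiding++xyz : allFin n ⊆ avoiding ++ xyz
    allFin⊆avoiding++xyz {t} _ with t ∈? triple x y z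
    ... | no t∉ = ∈-++⁺ˡ (∈-avoiding⁺ t∉)
    ... | yes t∈ with ∈triple⁻ x y z t∈
    ... | inj₁ refl = ∈-++⁺ʳ avoiding (here refl)
    ... | inj₂ (inj₁ refl) = ∈-++⁺ʳ avoiding (there (here refl))
    ... | inj₂ (inj₂ refl) = ∈-++⁺ʳ avoiding (there (there (here refl)))
    ≤n : length avoiding + 3 ≤ n
    ≤n = begin
      length avoiding + 3      ≡⟨ length-++ avoiding ⟨
      length (avoiding ++ xyz) ≤⟨ Unique-⊆⇒length≤ Unique-avoiding++xyz (λ {t} _ → ∈-allFin t) ⟩
      length (allFin n)        ≡⟨ length-tabulate (λ i → i) ⟩
      n                        ∎
    n≤ : n ≤ length avoiding + 3
    n≤ = begin
      n                        ≡⟨ length-tabulate (λ i → i) ⟨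
      length (allFin n)        ≤⟨ Unique-⊆⇒length≤ (Unique.allFin⁺ n) allFin⊆avoiding++xyz ⟩
      length (avoiding ++ xyz) ≡⟨ length-++ avoiding ⟩
      length avoiding + 3      ∎

-- Reachability

module _ {n : ℕ} (D : Digraph n) (X : Subset n) where

  Reach-∉ : ∀ {u t} → u ∉ X → Reach D X u t → t ∉ X
  Reach-∉ u∉X here = u∉X
  Reach-∉ _ (step _ _ t∉X) = t∉X

  ¬SC-closed : (S : Fin n → Set) → (∀ {w v} → w ∉ X → S w → D w v → v ∉ X → S v) →
    ∀ {s r} → S s → s ∉ X → r ∉ X → ¬ S r → ¬ StronglyConnectedMinus D X
  ¬SC-closed S closed {s} {r} s∈S s∉X r∉X r∉S sc = r∉S (reachable (sc s r s∉X r∉X))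
    where
    reachable : ∀ {t} → Reach D X s t → S t
    reachable here = s∈S
    reachable (step r arc t∉X) = closed (Reach-∉ s∉X r) (reachable r) arc t∉X

  Reach-pair⇒arc : ∀ {p q t} → p ∉ X → (∀ w → w ∉ X → w ≡ p ⊎ w ≡ q) → p ≢ q → Reach D X p t → t ≡ q → D p q
  Reach-pair⇒arc p∉X only p≢q here t≡q = ⊥-elim (p≢q t≡q)
  Reach-pair⇒arc p∉X only p≢q (step r arc _) refl with only _ (Reach-∉ p∉X r)
  ... | inj₁ refl = arc
  ... | inj₂ refl = Reach-pair⇒arc p∉X only p≢q r refl

-- The graph G = Γ(ℤ_n, {1, 2c}) with 3c = 1

module _ (n : ℕ) {{_ : NonZero n}} (c : ℕ) where
  open Modular n

  G : Digraph n
  G = Circ n (1 mod n) ((2 * c) mod n)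

  G-arc₁ : ∀ v → G v (v ⊕ 1)
  G-arc₁ v = subst (G v) (⊕-cong v (toℕ-mod 1)) (Circ-arcˡ n _ _ v)

  G-arc₂ : ∀ v → G v (v ⊕ 2 * c)
  G-arc₂ v = subst (G v) (⊕-cong v (toℕ-mod (2 * c))) (Circ-arcʳ n _ _ v)

  module _ (3c≈1 : 3 * c ≈ 1) (X : Subset n) (c-free : ∀ w → w ∈ X → w ⊕ c ∉ X) where

    ⊕c⊕2c : ∀ v → v ⊕ c ⊕ 2 * c ≡ v ⊕ 1
    ⊕c⊕2c v = trans (⊕-assoc v c (2 * c)) (⊕-cong v 3c≈1)

    ⊕2c⊕c : ∀ v → v ⊕ 2 * c ⊕ c ≡ v ⊕ 1
    ⊕2c⊕c v = trans (⊕-assoc v (2 * c) c) (trans (cong (v ⊕_) (+-comm (2 * c) c)) (⊕-cong v 3c≈1))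

    ⊕2c⊕2c : ∀ v → v ⊕ 2 * c ⊕ 2 * c ≡ v ⊕ 1 ⊕ c
    ⊕2c⊕2c v = begin
      v ⊕ 2 * c ⊕ 2 * c     ≡⟨ ⊕-assoc v (2 * c) (2 * c) ⟩
      v ⊕ (2 * c + 2 * c)   ≡⟨ cong (v ⊕_) (2c+2c≡3c+c c) ⟩
      v ⊕ (3 * c + c)       ≡⟨ ⊕-cong v (+-≈ 3c≈1 refl) ⟩
      v ⊕ (1 + c)           ≡⟨ ⊕-assoc v 1 c ⟨
      v ⊕ 1 ⊕ c             ∎
      where
      open ≡-Reasoning
      2c+2c≡3c+c : ∀ c → 2 * c + 2 * c ≡ 3 * c + c
      2c+2c≡3c+c = solve-∀

    ⊕c⊕1 : ∀ v → v ⊕ c ⊕ 1 ≡ v ⊕ 1 ⊕ c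
    ⊕c⊕1 v = trans (⊕-assoc v c 1) (trans (cong (v ⊕_) (+-comm c 1)) (sym (⊕-assoc v 1 c)))

    -- Walk from y along the arcs of length 1.  A removed vertex v ∈ X is
    -- replaced by its shadow v + c ∉ X: two arcs of length 2c lead from v to
    -- v + 1 + c, and one more leads from v + c back to v + 1.
    SC-G : StronglyConnectedMinus G X
    SC-G y t y∉X t∉X = proj₁ (subst Invariant (⊕-offset y t) (invariant (offset y t))) t∉X
      where
      R : Fin n → Set
      R = Reach G X y

      Invariant : Fin n → Set
      Invariant v = (v ∉ X → R v) × (v ∈ X → R (v ⊕ c))

      out→out : ∀ {v} → R v → v ⊕ 1 ∉ X → R (v ⊕ 1)
      out→out {v} r v+1∉X = step r (G-arc₁ v) v+1∉X

      out→in : ∀ {v} → R v → v ⊕ 1 ∈ X → R (v ⊕ 1 ⊕ c)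
      out→in {v} r v+1∈X = subst R (⊕2c⊕2c v) (step (step r (G-arc₂ v) v+2c∉X) (G-arc₂ (v ⊕ 2 * c))
        (subst (_∉ X) (sym (⊕2c⊕2c v)) (c-free _ v+1∈X)))
        where
        v+2c∉X : v ⊕ 2 * c ∉ X
        v+2c∉X v+2c∈X = c-free _ v+2c∈X (subst (_∈ X) (sym (⊕2c⊕c v)) v+1∈X)

      in→in : ∀ {v} → R (v ⊕ c) → v ⊕ 1 ∈ X → R (v ⊕ 1 ⊕ c)
      in→in {v} r v+1∈X = subst R (⊕c⊕1 v) (step r (G-arc₁ (v ⊕ c)) (subst (_∉ X) (sym (⊕c⊕1 v)) (c-free _ v+1∈X)))

      in→out : ∀ {v} → R (v ⊕ c) → v ⊕ 1 ∉ X → R (v ⊕ 1)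
      in→out {v} r v+1∉X = subst R (⊕c⊕2c v) (step r (G-arc₂ (v ⊕ c)) (subst (_∉ X) (sym (⊕c⊕2c v)) v+1∉X))

      invariant-suc : ∀ v → Invariant v → Invariant (v ⊕ 1)
      invariant-suc v (R-out , R-in) with v ∈? X
      ... | no v∉X = out→out (R-out v∉X) , out→in (R-out v∉X)
      ... | yes v∈X = in→out (R-in v∈X) , in→in (R-in v∈X)

      invariant : ∀ k → Invariant (y ⊕ k)
      invariant zero = subst Invariant (sym (⊕-identityʳ y)) ((λ _ → here) , λ y∈X → ⊥-elim (y∉X y∈X))
      invariant (suc k) = subst Invariant (trans (⊕-assoc y k 1) (cong (y ⊕_) (+-comm k 1)))
        (invariant-suc (y ⊕ k) (invariant k))

-- Families of 3-sets and the comparison of F₃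

module Triples (n : ℕ) {{_ : NonZero n}} where
  open Modular n

  ⊕-∈triple⁻ : ∀ u {i j p} → u ⊕ p ∈ triple u (u ⊕ i) (u ⊕ j) → p ≈ 0 ⊎ p ≈ i ⊎ p ≈ j
  ⊕-∈triple⁻ u {i} {j} {p} t∈ with ∈triple⁻ u (u ⊕ i) (u ⊕ j) t∈
  ... | inj₁ e = inj₁ (⊕-cancelˡ u (trans e (sym (⊕-identityʳ u))))
  ... | inj₂ (inj₁ e) = inj₂ (inj₁ (⊕-cancelˡ u e))
  ... | inj₂ (inj₂ e) = inj₂ (inj₂ (⊕-cancelˡ u e))

  ⊕-⊕-∈triple⁻ : ∀ u {i j p k} → u ⊕ p ⊕ k ∈ triple u (u ⊕ i) (u ⊕ j) →
    p + k ≈ 0 ⊎ p + k ≈ i ⊎ p + k ≈ j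
  ⊕-⊕-∈triple⁻ u {p = p} {k} t∈ = ⊕-∈triple⁻ u (subst (_∈ _) (⊕-assoc u p k) t∈)

  ∈triple-⊕⁻ : ∀ u {i j t} → t ∈ triple u (u ⊕ i) (u ⊕ j) → t ≡ u ⊕ 0 ⊎ t ≡ u ⊕ i ⊎ t ≡ u ⊕ j
  ∈triple-⊕⁻ u {i} {j} t∈ with ∈triple⁻ u (u ⊕ i) (u ⊕ j) t∈
  ... | inj₁ e = inj₁ (trans e (sym (⊕-identityʳ u)))
  ... | inj₂ e = inj₂ e

  ∣triple-⊕∣≡3 : ∀ u {i j} → ¬ i ≈ 0 → ¬ j ≈ 0 → ¬ i ≈ j → ∣ triple u (u ⊕ i) (u ⊕ j) ∣ ≡ 3
  ∣triple-⊕∣≡3 u i≉0 j≉0 i≉j = ∣triple∣≡3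
    (λ e → i≉0 (sym (⊕-cancelˡ u (trans (⊕-identityʳ u) e))))
    (λ e → j≉0 (sym (⊕-cancelˡ u (trans (⊕-identityʳ u) e))))
    (λ e → i≉j (⊕-cancelˡ u e))

module Family (n : ℕ) {{_ : NonZero n}} (d : ℕ) (d≉0 : ¬ Modular._≈_ n d 0) (2d≉0 : ¬ Modular._≈_ n (d + d) 0) where
  open Modular n
  open Triples n

  excluded : Subset n
  excluded = triple (0 mod n) (d mod n) (neg d mod n)

  Admissible : Fin n → Set
  Admissible s = s ∉ excluded

  module _ {s : Fin n} (adm : Admissible s) where

    adm-≉0 : ¬ toℕ s ≈ 0
    adm-≉0 e = adm (subst (_∈ excluded) (sym (≈⇒≡-mod e)) (∈triple₁ _ _ _))

    adm-≉d : ¬ toℕ s ≈ d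
    adm-≉d e = adm (subst (_∈ excluded) (sym (≈⇒≡-mod e)) (∈triple₂ _ _ _))

    adm-≉neg : ¬ d + toℕ s ≈ 0
    adm-≉neg e = adm (subst (_∈ excluded) (sym (≈⇒≡-mod (+-≈0⇒≈neg d e))) (∈triple₃ _ _ _))

  private
    0≢d : 0 mod n ≢ d mod n
    0≢d e = d≉0 (sym (mod-≡⇒≈ e))
    0≢-d : 0 mod n ≢ neg d mod n
    0≢-d e = d≉0 (trans (cong (_% n) (sym (+-identityʳ d))) (≈neg⇒+-≈0 d (mod-≡⇒≈ e)))
    d≢-d : d mod n ≢ neg d mod n
    d≢-d e = 2d≉0 (≈neg⇒+-≈0 d (mod-≡⇒≈ e))

  indices : List (Fin n × Fin n)
  indices = cartesianProduct (allFin n) (avoiding 0≢d 0≢-d d≢-d)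

  ∈-indices⁻ : ∀ {u s} → (u , s) ∈ₗ indices → Admissible s
  ∈-indices⁻ p∈ = ∈-avoiding⁻ 0≢d 0≢-d d≢-d (proj₂ (∈-cartesianProduct⁻ (allFin n) _ p∈))

  ∈-indices⁺ : ∀ u {s} → Admissible s → (u , s) ∈ₗ indices
  ∈-indices⁺ u adm = ∈-cartesianProduct⁺ (∈-allFin u) (∈-avoiding⁺ 0≢d 0≢-d d≢-d adm)

  Unique-indices : Unique indices
  Unique-indices = Unique.cartesianProduct⁺ (Unique.allFin⁺ n) (Unique-avoiding 0≢d 0≢-d d≢-d)

  length-indices : length indices ≡ n * (n ∸ 3)
  length-indices = trans (length-cartesianProduct (allFin n) _)
    (cong₂ _*_ (length-tabulate {n = n} (λ i → i)) (length-avoiding 0≢d 0≢-d d≢-d))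

  module Indexed (f : Fin n → Fin n → Subset n)
    (f-injective : ∀ {u s u' s'} → Admissible s → Admissible s' → f u s ≡ f u' s' → u ≡ u' × s ≡ s') where

    family : List (Subset n)
    family = map (uncurry f) indices

    Unique-family : Unique family
    Unique-family = map⁺-Unique (uncurry f) Unique-indices injective
      where
      injective : ∀ {p q} → p ∈ₗ indices → q ∈ₗ indices → uncurry f p ≡ uncurry f q → p ≡ q
      injective {u , s} {u' , s'} p∈ q∈ e with refl , refl ← f-injective (∈-indices⁻ p∈) (∈-indices⁻ q∈) e = refl

    length-family : length family ≡ n * (n ∸ 3)
    length-family = trans (length-map (uncurry f) indices) length-indices

    ∈-family⁻ : ∀ {X} → X ∈ₗ family → ∃[ u ] ∃[ s ] Admissible s × X ≡ f u s
    ∈-family⁻ X∈ with (u , s) , p∈ , refl ← ∈-map⁻ (uncurry f) X∈ = u , s , ∈-indices⁻ p∈ , refl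

    ∈-family⁺ : ∀ u {s} → Admissible s → f u s ∈ₗ family
    ∈-family⁺ u adm = ∈-map⁺ (uncurry f) (∈-indices⁺ u adm)

  φ : Fin n → Fin n → Subset n
  φ u s = triple u (u ⊕ d) (u ⊕ toℕ s)

  ∣φ∣≡3 : ∀ u {s} → Admissible s → ∣ φ u s ∣ ≡ 3
  ∣φ∣≡3 u adm = ∣triple-⊕∣≡3 u d≉0 (adm-≉0 adm) (λ e → adm-≉d adm (sym e))

  -- Locate u' in φ u s: u' = u forces s' = s, while u' = u + d and u' = u + s
  -- contradict the admissibility of s or s'.
  φ-injective : ∀ {u s u' s'} → Admissible s → Admissible s' → φ u s ≡ φ u' s' → u ≡ u' × s ≡ s'
  φ-injective {u} {s} {u'} {s'} adm adm' e with ∈triple-⊕⁻ u (subst (u' ∈_) (sym e) (∈triple₁ u' _ _))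
  ... | inj₁ refl with ⊕-⊕-∈triple⁻ u (subst (_ ∈_) (sym e) (∈triple₃ u' _ _))
  ...   | inj₁ s'≈0 = ⊥-elim (adm-≉0 adm' s'≈0)
  ...   | inj₂ (inj₁ s'≈d) = ⊥-elim (adm-≉d adm' s'≈d)
  ...   | inj₂ (inj₂ s'≈s) = sym (⊕-identityʳ u) , toℕ-≈-injective (sym s'≈s)
  φ-injective {u} {s} {u'} {s'} adm adm' e | inj₂ (inj₁ refl) with ⊕-⊕-∈triple⁻ u (subst (_ ∈_) (sym e) (∈triple₂ u' _ _))
  ...   | inj₁ 2d≈0 = ⊥-elim (2d≉0 2d≈0)
  ...   | inj₂ (inj₁ 2d≈d) = ⊥-elim (d≉0 (x+y≈x⇒y≈0 d 2d≈d))
  ...   | inj₂ (inj₂ 2d≈s) with ⊕-⊕-∈triple⁻ u {p = d} {k = toℕ s'} (subst (_ ∈_) (sym e) (∈triple₃ u' _ _))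
  ...     | inj₁ d+s'≈0 = ⊥-elim (adm-≉neg adm' d+s'≈0)
  ...     | inj₂ (inj₁ d+s'≈d) = ⊥-elim (adm-≉0 adm' (x+y≈x⇒y≈0 d d+s'≈d))
  ...     | inj₂ (inj₂ d+s'≈s) = ⊥-elim (adm-≉d adm' (+-cancelˡ-≈ d (trans d+s'≈s (sym 2d≈s))))
  φ-injective {u} {s} {u'} {s'} adm adm' e | inj₂ (inj₂ refl) with ⊕-⊕-∈triple⁻ u {p = toℕ s} {k = d} (subst (_ ∈_) (sym e) (∈triple₂ u' _ _))
  ...   | inj₁ s+d≈0 = ⊥-elim (adm-≉neg adm (trans (cong (_% n) (+-comm d (toℕ s))) s+d≈0))
  ...   | inj₂ (inj₁ s+d≈d) = ⊥-elim (adm-≉0 adm (x+y≈x⇒y≈0 d (trans (cong (_% n) (+-comm d (toℕ s))) s+d≈d)))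
  ...   | inj₂ (inj₂ s+d≈s) = ⊥-elim (d≉0 (x+y≈x⇒y≈0 (toℕ s) s+d≈s))

  open Indexed φ φ-injective public

module _ {n i : ℕ} {D D' : Digraph n} where

  F≤F-via-bad-sets : ∀ {k k'} → IsF i D k → IsF i D' k' → (badG badH : List (Subset n)) → Unique badH →
    (∀ {X} → X ∈ₗ badH → ∣ X ∣ ≡ i × ¬ StronglyConnectedMinus D' X) →
    (∀ X → ∣ X ∣ ≡ i → StronglyConnectedMinus D X ⊎ X ∈ₗ badG) →
    length badG ≤ length badH → k' ≤ k
  F≤F-via-bad-sets (xsG , _ , specG , refl) (xsH , uniqueH , specH , refl) badG badH uniqueBad badH-spec cover len =
    +-cancelʳ-≤ (length badH) _ _ (begin
      length xsH + length badH    ≡⟨ length-++ xsH ⟨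
      length (xsH ++ badH)        ≤⟨ Unique-⊆⇒length≤ (Unique.++⁺ uniqueH uniqueBad disjoint) sub ⟩
      length (xsG ++ badG)        ≡⟨ length-++ xsG ⟩
      length xsG + length badG    ≤⟨ +-monoʳ-≤ (length xsG) len ⟩
      length xsG + length badH    ∎)
    where
    open ≤-Reasoning
    disjoint : ∀ {X} → ¬ (X ∈ₗ xsH × X ∈ₗ badH)
    disjoint {X} (X∈xsH , X∈badH) = proj₂ (badH-spec X∈badH) (proj₂ (Equivalence.to (specH X) X∈xsH))
    card : ∀ {X} → X ∈ₗ xsH ⊎ X ∈ₗ badH → ∣ X ∣ ≡ i
    card {X} (inj₁ X∈xsH) = proj₁ (Equivalence.to (specH X) X∈xsH)
    card (inj₂ X∈badH) = proj₁ (badH-spec X∈badH)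
    sub : xsH ++ badH ⊆ xsG ++ badG
    sub {X} X∈ with cover X (card (∈-++⁻ xsH X∈))
    ... | inj₁ sc = ∈-++⁺ˡ (Equivalence.from (specG X) (card (∈-++⁻ xsH X∈) , sc))
    ... | inj₂ X∈badG = ∈-++⁺ʳ xsG X∈badG

Obstructions : (n : ℕ) → Digraph n → Set
Obstructions n H = Σ[ bad ∈ List (Subset n) ]
  Unique bad × (∀ {X} → X ∈ₗ bad → ∣ X ∣ ≡ 3 × ¬ StronglyConnectedMinus H X) × length bad ≡ n * (n ∸ 3)

module _ (n : ℕ) {{_ : NonZero n}} (2<n : 2 < n) (c : ℕ) (3c≈1 : Modular._≈_ n (3 * c) 1) where
  open Modular n

  private
    1≉0 : ¬ 1 ≈ 0
    1≉0 = ≢0⇒≉0 (<⇒≤ 2<n) (λ ())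

    c≉0 : ¬ c ≈ 0
    c≉0 c≈0 = 1≉0 (trans (sym 3c≈1) (*-≈ 3 c≈0))

    2*c≡c+c : 2 * c ≡ c + c
    2*c≡c+c = cong (c +_) (+-identityʳ c)

    2c≉0 : ¬ c + c ≈ 0
    2c≉0 2c≈0 = ≢0⇒≉0 2<n (λ ()) (begin
      2 % n                ≡⟨ *-≈ 2 3c≈1 ⟨
      (2 * (3 * c)) % n    ≡⟨ cong (_% n) (2[3c]≡3[c+c] c) ⟩
      (3 * (c + c)) % n    ≡⟨ *-≈ 3 2c≈0 ⟩
      0 % n                ∎)
      where
      open ≡-Reasoning
      2[3c]≡3[c+c] : ∀ c → 2 * (3 * c) ≡ 3 * (c + c)
      2[3c]≡3[c+c] = solve-∀

  open Family n c c≉0 2c≉0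

  private
    2c-admissible : Admissible (2 * c mod n)
    2c-admissible 2c∈ with ∈triple⁻ _ _ _ 2c∈
    ... | inj₁ 2c≡0 = 2c≉0 (trans (cong (_% n) (sym 2*c≡c+c)) (mod-≡⇒≈ 2c≡0))
    ... | inj₂ (inj₁ 2c≡c) = c≉0 (x+y≈x⇒y≈0 c (trans (cong (_% n) (sym 2*c≡c+c)) (mod-≡⇒≈ 2c≡c)))
    ... | inj₂ (inj₂ 2c≡-c) = 1≉0 (trans (sym 3c≈1) (≈neg⇒+-≈0 c (mod-≡⇒≈ 2c≡-c)))

  -- {w, w + c, z} is φ w s for the offset s of z, unless s = −c; then it is φ z (2c).
  triple-⊕c∈family : ∀ w {z} → z ≢ w → z ≢ w ⊕ c → triple w (w ⊕ c) z ∈ₗ family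
  triple-⊕c∈family w {z} z≢w z≢w⊕c with offset w z mod n ∈? excluded
  ... | no adm = subst (_∈ₗ family) (cong (triple w (w ⊕ c)) (⊕-offset-mod w z)) (∈-family⁺ w adm)
  ... | yes s∈ with ∈triple⁻ _ _ _ s∈
  ... | inj₁ s≡0 = ⊥-elim (z≢w (trans (sym (⊕-offset-mod w z)) (trans (⊕-cong w (≡-mod⇒≈ s≡0)) (⊕-identityʳ w))))
  ... | inj₂ (inj₁ s≡c) = ⊥-elim (z≢w⊕c (trans (sym (⊕-offset-mod w z)) (⊕-cong w (≡-mod⇒≈ s≡c))))
  ... | inj₂ (inj₂ s≡-c) = subst (_∈ₗ family) φz≡ (∈-family⁺ z 2c-admissible)
    where
    z≡w⊕-c : z ≡ w ⊕ neg c
    z≡w⊕-c = trans (sym (⊕-offset-mod w z)) (⊕-cong w (≡-mod⇒≈ s≡-c))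
    z⊕c≡w : z ⊕ c ≡ w
    z⊕c≡w = trans (cong (_⊕ c) z≡w⊕-c)
      (trans (⊕-assoc w (neg c) c) (trans (⊕-cong w (neg-inverseˡ c)) (⊕-identityʳ w)))
    z⊕2c≡w⊕c : z ⊕ toℕ (2 * c mod n) ≡ w ⊕ c
    z⊕2c≡w⊕c = trans (⊕-cong z (trans (toℕ-mod (2 * c)) (cong (_% n) 2*c≡c+c)))
      (trans (sym (⊕-assoc z c c)) (cong (_⊕ c) z⊕c≡w))
    φz≡ : φ z (2 * c mod n) ≡ triple w (w ⊕ c) z
    φz≡ = trans (cong₂ (triple z) z⊕c≡w z⊕2c≡w⊕c) (sym (triple-rotate w (w ⊕ c) z))

  G-cover : ∀ X → ∣ X ∣ ≡ 3 → StronglyConnectedMinus (G n c) X ⊎ X ∈ₗ family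
  G-cover X ∣X∣≡3 with any? (λ w → (w ∈? X) ×-dec (w ⊕ c ∈? X))
  ... | no no-pair = inj₁ (SC-G n c 3c≈1 X (λ w w∈X w⊕c∈X → no-pair (w , w∈X , w⊕c∈X)))
  ... | yes (w , w∈X , w⊕c∈X) with ∣X∣≡3⇒triple X ∣X∣≡3 w∈X w⊕c∈X w≢w⊕c
    where
    w≢w⊕c : w ≢ w ⊕ c
    w≢w⊕c e = c≉0 (sym (⊕-cancelˡ w (trans (⊕-identityʳ w) e)))
  ... | z , z≢w , z≢w⊕c , refl = inj₂ (triple-⊕c∈family w z≢w z≢w⊕c)

  obstructions⇒F₃≤F₃-G : ∀ {H : Digraph n} {kG kH} → IsF 3 (G n c) kG → IsF 3 H kH → Obstructions n H → kH ≤ kG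
  obstructions⇒F₃≤F₃-G F-G F-H (bad , unique , obstruct , length-bad) =
    F≤F-via-bad-sets F-G F-H family bad unique obstruct G-cover (≤-reflexive (trans length-family (sym length-bad)))


-- Obstructions in H = Γ(ℤ_n, {a, b})

module Trapped (n : ℕ) {{_ : NonZero n}} (5≤n : 5 ≤ n) (a b : Fin n) (X : Subset n) (∣X∣≡3 : ∣ X ∣ ≡ 3) where
  open Modular n

  private
    2≤∣∁X∣ : 2 ≤ ∣ ∁ X ∣
    2≤∣∁X∣ = ≤-trans (∸-monoˡ-≤ 3 5≤n) (≤-reflexive (sym (trans (∣∁p∣≡n∸∣p∣ X) (cong (n ∸_) ∣X∣≡3))))

  ∃-∉-≢ : ∀ v → ∃[ r ] r ∉ X × r ≢ v
  ∃-∉-≢ v with r , r∈∁X , r≢v ← ∃-∈-≢ (∁ X) 2≤∣∁X∣ v = r , x∈∁p⇒x∉p r∈∁X , r≢v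

  out-trapped : ∀ {v} → v ∉ X → v ⊕ toℕ a ∈ X → v ⊕ toℕ b ∈ X → ¬ StronglyConnectedMinus (Circ n a b) X
  out-trapped {v} v∉X v⊕a∈X v⊕b∈X with r , r∉X , r≢v ← ∃-∉-≢ v =
    ¬SC-closed (Circ n a b) X (_≡ v) closed refl v∉X r∉X r≢v
    where
    closed : ∀ {w t} → w ∉ X → w ≡ v → Circ n a b w t → t ∉ X → t ≡ v
    closed {t = t} _ refl arc t∉X with Circ-arc⁻ n a b {v} {t} arc
    ... | inj₁ refl = ⊥-elim (t∉X v⊕a∈X)
    ... | inj₂ refl = ⊥-elim (t∉X v⊕b∈X)

  in-trapped : ∀ {t} → t ∉ X → t ⊕ neg (toℕ a) ∈ X → t ⊕ neg (toℕ b) ∈ X → ¬ StronglyConnectedMinus (Circ n a b) X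
  in-trapped {t} t∉X t⊕-a∈X t⊕-b∈X with r , r∉X , r≢t ← ∃-∉-≢ t =
    ¬SC-closed (Circ n a b) X (_≢ t) closed r≢t r∉X t∉X (λ t≢t → t≢t refl)
    where
    closed : ∀ {w t'} → w ∉ X → w ≢ t → Circ n a b w t' → t' ∉ X → t' ≢ t
    closed {w} {t'} w∉X _ arc _ t'≡t with Circ-arc⁻ n a b {w} {t'} arc
    ... | inj₁ t'≡w⊕a = w∉X (subst (_∈ X) (trans (cong (_⊕ neg (toℕ a)) (trans (sym t'≡t) t'≡w⊕a)) (⊕-⊕neg w (toℕ a))) t⊕-a∈X)
    ... | inj₂ t'≡w⊕b = w∉X (subst (_∈ X) (trans (cong (_⊕ neg (toℕ b)) (trans (sym t'≡t) t'≡w⊕b)) (⊕-⊕neg w (toℕ b))) t⊕-b∈X)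

-- For a + b ≢ 0 the obstructions are {u, u + d, u + s} with d = b − a.
module NonCycle (n : ℕ) {{_ : NonZero n}} (5≤n : 5 ≤ n) (odd : n % 2 ≡ 1) (a b : Fin n) (a≢b : a ≢ b)
  (a≉0 : ¬ Modular._≈_ n (toℕ a) 0) (b≉0 : ¬ Modular._≈_ n (toℕ b) 0)
  (a+b≉0 : ¬ Modular._≈_ n (toℕ a + toℕ b) 0) where
  open Modular n
  open Triples n

  A B d : ℕ
  A = toℕ a
  B = toℕ b
  d = B + neg A

  d≉0 : ¬ d ≈ 0
  d≉0 d≈0 = a≢b (toℕ-≈-injective (begin
    A % n                   ≡⟨ +-≈ {0} (sym d≈0) refl ⟩
    (d + A) % n             ≡⟨ cong (_% n) (+-assoc B (neg A) A) ⟩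
    (B + (neg A + A)) % n   ≡⟨ +-≈ {B} refl (neg-inverseˡ A) ⟩
    (B + 0) % n             ≡⟨ cong (_% n) (+-identityʳ B) ⟩
    B % n                   ∎))
    where open ≡-Reasoning

  open Family n d d≉0 (λ d+d≈0 → d≉0 (x+x≈0⇒x≈0 odd d d+d≈0)) public

  -- u − a is trapped (its out-neighbours u, u + d are removed) unless u − a ∈ φ u s,
  -- and u + b is trapped (its in-neighbours u + d, u are removed) unless u + b ∈ φ u s;
  -- both memberships together force s = −a = b, i.e. a + b = 0.
  ¬SC-φ : ∀ u {s} → Admissible s → ¬ StronglyConnectedMinus (Circ n a b) (φ u s)
  ¬SC-φ u {s} adm with u ⊕ neg A ∈? φ u s | u ⊕ B ∈? φ u s
  ... | no u-a∉ | _ = out-trapped u-a∉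
    (subst (_∈ φ u s) (sym (trans (⊕-assoc u (neg A) A) (trans (⊕-cong u (neg-inverseˡ A)) (⊕-identityʳ u))))
      (∈triple₁ _ _ _))
    (subst (_∈ φ u s) (sym (trans (⊕-assoc u (neg A) B) (cong (u ⊕_) (+-comm (neg A) B)))) (∈triple₂ _ _ _))
    where open Trapped n 5≤n a b (φ u s) (∣φ∣≡3 u adm)
  ... | yes _ | no u+b∉ = in-trapped u+b∉
    (subst (_∈ φ u s) (sym (⊕-assoc u B (neg A))) (∈triple₂ _ _ _))
    (subst (_∈ φ u s) (sym (⊕-⊕neg u B)) (∈triple₁ _ _ _))
    where open Trapped n 5≤n a b (φ u s) (∣φ∣≡3 u adm)
  ... | yes u-a∈ | yes u+b∈ = λ _ → contradiction (⊕-∈triple⁻ u u-a∈) (⊕-∈triple⁻ u u+b∈)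
    where
    contradiction : _ → _ → ⊥
    contradiction (inj₁ -a≈0) _ = a≉0 (neg≈0⇒≈0 -a≈0)
    contradiction (inj₂ (inj₁ -a≈d)) _ = b≉0 (x+y≈x⇒y≈0 (neg A) (trans (cong (_% n) (+-comm (neg A) B)) (sym -a≈d)))
    contradiction _ (inj₁ b≈0) = b≉0 b≈0
    contradiction _ (inj₂ (inj₁ b≈d)) = a≉0 (neg≈0⇒≈0 (x+y≈x⇒y≈0 B (sym b≈d)))
    contradiction (inj₂ (inj₂ -a≈s)) (inj₂ (inj₂ b≈s)) = a+b≉0 (trans (+-≈ {A} refl (trans b≈s (sym -a≈s))) (neg-inverseʳ A))

*a≈0⇒≈0 : ∀ n {{_ : NonZero n}} (a b : Fin n) → Generates n a b → Modular._≈_ n (toℕ a + toℕ b) 0 →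
  ∀ j → Modular._≈_ n (j * toℕ a) 0 → Modular._≈_ n j 0
*a≈0⇒≈0 n a b gen a+b≈0 j ja≈0 with k , l , ka+lb≡1 ← gen (1 mod n) = begin
  j % n                            ≡⟨ cong (_% n) (*-identityʳ j) ⟨
  (j * 1) % n                      ≡⟨ *-≈ j (trans ka+lb≡1 (toℕ-fromℕ< _)) ⟨
  (j * (k * A + l * B)) % n        ≡⟨ cong (_% n) (distrib j k l A B) ⟩
  (k * (j * A) + l * (j * B)) % n  ≡⟨ +-≈ (*-≈ k ja≈0) (*-≈ l jb≈0) ⟩
  (k * 0 + l * 0) % n              ≡⟨ cong₂ (λ x y → (x + y) % n) (*-zeroʳ k) (*-zeroʳ l) ⟩
  0 % n                            ∎
  where
  open Modular n
  open ≡-Reasoning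
  A = toℕ a
  B = toℕ b
  distrib : ∀ j k l A B → j * (k * A + l * B) ≡ k * (j * A) + l * (j * B)
  distrib = solve-∀
  jb≈0 : j * B ≈ 0
  jb≈0 = x+y≈x⇒y≈0 (j * A) (begin
    (j * A + j * B) % n   ≡⟨ cong (_% n) (*-distribˡ-+ j A B) ⟨
    (j * (A + B)) % n     ≡⟨ *-≈ j a+b≈0 ⟩
    (j * 0) % n           ≡⟨ cong (_% n) (*-zeroʳ j) ⟩
    0 % n                 ≡⟨ ja≈0 ⟨
    (j * A) % n           ∎)

-- For b = −a the sets {u, u + a, u + 2a} leave a path of the cycle, so the
-- obstructions use {u, u + a, u + 4a} instead.
module Cycle (n : ℕ) {{_ : NonZero n}} (7≤n : 7 ≤ n) (a b : Fin n)
  (a+b≈0 : Modular._≈_ n (toℕ a + toℕ b) 0) (gen : Generates n a b) where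
  open Modular n
  open Triples n

  A B : ℕ
  A = toℕ a
  B = toℕ b

  *A-≈⇒≡ : ∀ {i j} → i ≤ j → j < n → i * A ≈ j * A → j ≡ i
  *A-≈⇒≡ {i} {j} i≤j j<n e = trans (sym (m∸n+n≡m i≤j)) (cong (_+ i) k≡0)
    where
    k = j ∸ i
    kA≈0 : k * A ≈ 0
    kA≈0 = x+y≈x⇒y≈0 (i * A) (begin
      (i * A + k * A) % n   ≡⟨ cong (_% n) (+-comm (i * A) (k * A)) ⟩
      (k * A + i * A) % n   ≡⟨ cong (_% n) (*-distribʳ-+ A k i) ⟨
      ((k + i) * A) % n     ≡⟨ cong (λ m → (m * A) % n) (m∸n+n≡m i≤j) ⟩
      (j * A) % n           ≡⟨ e ⟨
      (i * A) % n           ∎)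
      where open ≡-Reasoning
    k≡0 : k ≡ 0
    k≡0 = ≈⇒≡ (≤-<-trans (m∸n≤m j i) j<n) 0<n (*a≈0⇒≈0 n a b gen a+b≈0 k kA≈0)

  *A-injective : ∀ {i j} → i < n → j < n → i * A ≈ j * A → i ≡ j
  *A-injective {i} {j} i<n j<n e with ≤-total i j
  ... | inj₁ i≤j = sym (*A-≈⇒≡ i≤j j<n e)
  ... | inj₂ j≤i = *A-≈⇒≡ j≤i i<n (sym e)

  ⊕*A-distinct : ∀ u i j {_ : True (i ≤? 6)} {_ : True (j ≤? 6)} {_ : False (i ≟ j)} → u ⊕ i * A ≢ u ⊕ j * A
  ⊕*A-distinct u i j {i≤6} {j≤6} {i≢j} e = toWitnessFalse i≢j
    (*A-injective (≤-trans (s≤s (toWitness i≤6)) 7≤n) (≤-trans (s≤s (toWitness j≤6)) 7≤n) (⊕-cancelˡ u e))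

  ⊕*A-⊕A : ∀ u i → u ⊕ i * A ⊕ A ≡ u ⊕ suc i * A
  ⊕*A-⊕A u i = trans (⊕-assoc u (i * A) A) (cong (u ⊕_) (+-comm (i * A) A))

  ⊕*A-⊕B : ∀ u i → u ⊕ suc i * A ⊕ B ≡ u ⊕ i * A
  ⊕*A-⊕B u i = trans (⊕-assoc u (suc i * A) B) (⊕-cong u (begin
    (A + i * A + B) % n     ≡⟨ cong (_% n) (rearrange A (i * A) B) ⟩
    (i * A + (A + B)) % n   ≡⟨ +-≈ {i * A} refl a+b≈0 ⟩
    (i * A + 0) % n         ≡⟨ cong (_% n) (+-identityʳ (i * A)) ⟩
    (i * A) % n             ∎))
    where
    open ≡-Reasoning
    rearrange : ∀ x y z → x + y + z ≡ y + (x + z)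
    rearrange = solve-∀

  ⊕*A-⊕*A : ∀ u {w} i j → w ≡ u ⊕ i * A → w ⊕ j * A ≡ u ⊕ (i + j) * A
  ⊕*A-⊕*A u i j refl = trans (⊕-assoc u (i * A) (j * A)) (cong (u ⊕_) (sym (*-distribʳ-+ A i j)))

  2A≉0 : ¬ 2 * A ≈ 0
  2A≉0 e = ⊕*A-distinct a 2 0 (⊕-cong a e)

  4A≉0 : ¬ 2 * A + 2 * A ≈ 0
  4A≉0 e = ⊕*A-distinct a 4 0 (⊕-cong a (trans (cong (_% n) (*-distribʳ-+ A 2 2)) e))

  open Family n (2 * A) 2A≉0 4A≉0 public

  Y : Fin n → Subset n
  Y u = triple u (u ⊕ 1 * A) (u ⊕ 4 * A)

  ∣Y∣≡3 : ∀ u → ∣ Y u ∣ ≡ 3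
  ∣Y∣≡3 u = ∣triple∣≡3 (λ e → ⊕*A-distinct u 0 1 (trans (⊕-identityʳ u) e))
    (λ e → ⊕*A-distinct u 0 4 (trans (⊕-identityʳ u) e)) (⊕*A-distinct u 1 4)

  ⊕*A∉Y : ∀ u i {_ : True (i ≤? 6)} {_ : False (i ≟ 0)} {_ : False (i ≟ 1)} {_ : False (i ≟ 4)} → u ⊕ i * A ∉ Y u
  ⊕*A∉Y u i {i≤6} {i≢0} {i≢1} {i≢4} i∈ with ∈triple-⊕⁻ u i∈
  ... | inj₁ e = ⊕*A-distinct u i 0 {i≤6} {_} {i≢0} e
  ... | inj₂ (inj₁ e) = ⊕*A-distinct u i 1 {i≤6} {_} {i≢1} e
  ... | inj₂ (inj₂ e) = ⊕*A-distinct u i 4 {i≤6} {_} {i≢4} e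

  ψ : Fin n → Fin n → Subset n
  ψ u s with toℕ s ≟ A
  ... | yes _ = Y u
  ... | no _ = φ u s

  ∣ψ∣≡3 : ∀ u {s} → Admissible s → ∣ ψ u s ∣ ≡ 3
  ∣ψ∣≡3 u {s} adm with toℕ s ≟ A
  ... | yes _ = ∣Y∣≡3 u
  ... | no _ = ∣φ∣≡3 u adm

  Y-2a-free : ∀ u {w} → w ∈ Y u → w ⊕ 2 * A ∉ Y u
  Y-2a-free u w∈ w+2a∈ with ∈triple-⊕⁻ u w∈
  ... | inj₁ w≡ = ⊕*A∉Y u 2 (subst (_∈ Y u) (⊕*A-⊕*A u 0 2 w≡) w+2a∈)
  ... | inj₂ (inj₁ w≡) = ⊕*A∉Y u 3 (subst (_∈ Y u) (⊕*A-⊕*A u 1 2 w≡) w+2a∈)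
  ... | inj₂ (inj₂ w≡) = ⊕*A∉Y u 6 (subst (_∈ Y u) (⊕*A-⊕*A u 4 2 w≡) w+2a∈)

  Y-a-step : ∀ u {w} → w ∈ Y u → w ⊕ 1 * A ∈ Y u → w ≡ u
  Y-a-step u w∈ w+a∈ with ∈triple-⊕⁻ u w∈
  ... | inj₁ w≡ = trans w≡ (⊕-identityʳ u)
  ... | inj₂ (inj₁ w≡) = ⊥-elim (⊕*A∉Y u 2 (subst (_∈ Y u) (⊕*A-⊕*A u 1 1 w≡) w+a∈))
  ... | inj₂ (inj₂ w≡) = ⊥-elim (⊕*A∉Y u 5 (subst (_∈ Y u) (⊕*A-⊕*A u 4 1 w≡) w+a∈))

  Y≢φ : ∀ u u' s' → Y u ≢ φ u' s'
  Y≢φ u u' s' e = Y-2a-free u (subst (u' ∈_) (sym e) (∈triple₁ _ _ _)) (subst (_ ∈_) (sym e) (∈triple₂ _ _ _))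

  ψ-injective : ∀ {u s u' s'} → Admissible s → Admissible s' → ψ u s ≡ ψ u' s' → u ≡ u' × s ≡ s'
  ψ-injective {u} {s} {u'} {s'} adm adm' e with toℕ s ≟ A | toℕ s' ≟ A
  ... | yes s≡a | yes s'≡a = sym (Y-a-step u (subst (u' ∈_) (sym e) (∈triple₁ _ _ _)) (subst (_ ∈_) (sym e) (∈triple₂ _ _ _))) ,
                            toℕ-injective (trans s≡a (sym s'≡a))
  ... | yes _ | no _ = ⊥-elim (Y≢φ u u' s' e)
  ... | no _ | yes _ = ⊥-elim (Y≢φ u' u s (sym e))
  ... | no _ | no _ = φ-injective adm adm' e

  module Ψ = Indexed ψ ψ-injective

  -- φ u s traps u + a; Y u separates {u + 2a, u + 3a} from the rest of the cycle.
  ¬SC-ψ : ∀ u {s} → Admissible s → ¬ StronglyConnectedMinus (Circ n a b) (ψ u s)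
  ¬SC-ψ u {s} adm with toℕ s ≟ A
  ... | no s≢a = out-trapped u+a∉φ (subst (_∈ φ u s) (sym (⊕*A-⊕A u 1)) (∈triple₂ _ _ _))
                                   (subst (_∈ φ u s) (sym (trans (⊕*A-⊕B u 0) (⊕-identityʳ u))) (∈triple₁ _ _ _))
    where
    open Trapped n (≤-trans (m≤m+n 5 2) 7≤n) a b (φ u s) (∣φ∣≡3 u adm)
    u+a∉φ : u ⊕ 1 * A ∉ φ u s
    u+a∉φ u+a∈ with ∈triple-⊕⁻ u u+a∈
    ... | inj₁ e = ⊕*A-distinct u 1 0 e
    ... | inj₂ (inj₁ e) = ⊕*A-distinct u 1 2 e
    ... | inj₂ (inj₂ e) = s≢a (sym (≈⇒≡ (toℕ<n a) (toℕ<n s) (trans (cong (_% n) (sym (+-identityʳ A))) (⊕-cancelˡ u e))))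
  ... | yes _ = ¬SC-closed (Circ n a b) (Y u) S closed (inj₁ refl) (⊕*A∉Y u 2) (⊕*A∉Y u 5) u+5a∉S
    where
    S : Fin n → Set
    S w = w ≡ u ⊕ 2 * A ⊎ w ≡ u ⊕ 3 * A
    u+5a∉S : ¬ S (u ⊕ 5 * A)
    u+5a∉S (inj₁ e) = ⊕*A-distinct u 5 2 e
    u+5a∉S (inj₂ e) = ⊕*A-distinct u 5 3 e
    closed : ∀ {w t} → w ∉ Y u → S w → Circ n a b w t → t ∉ Y u → S t
    closed {t = t} _ (inj₁ refl) arc t∉Y with Circ-arc⁻ n a b {_} {t} arc
    ... | inj₁ t≡ = inj₂ (trans t≡ (⊕*A-⊕A u 2))
    ... | inj₂ t≡ = ⊥-elim (t∉Y (subst (_∈ Y u) (sym (trans t≡ (⊕*A-⊕B u 1))) (∈triple₂ _ _ _)))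
    closed {t = t} _ (inj₂ refl) arc t∉Y with Circ-arc⁻ n a b {_} {t} arc
    ... | inj₁ t≡ = ⊥-elim (t∉Y (subst (_∈ Y u) (sym (trans t≡ (⊕*A-⊕A u 3))) (∈triple₃ _ _ _)))
    ... | inj₂ t≡ = inj₁ (trans t≡ (⊕*A-⊕B u 2))

-- For n = 5 every 3-set is the complement of a pair, and H − X can only be
-- strongly connected if that pair is an arc {p, p + a} of H.
module Five (n : ℕ) {{_ : NonZero n}} (n≡5 : n ≡ 5) where
  open Modular n

  co-pair : Fin n → ℕ → Subset n
  co-pair p k = ∁ (⁅ p ⁆ ∪ ⁅ p ⊕ k ⁆)

  ∣X∣≡3⇒∁pair : ∀ (X : Subset n) → ∣ X ∣ ≡ 3 → ∃[ p ] ∃[ q ] p ≢ q × X ≡ ∁ (⁅ p ⁆ ∪ ⁅ q ⁆)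
  ∣X∣≡3⇒∁pair X ∣X∣≡3 with p , q , p≢q , ∁X≡ ← ∣P∣≡2⇒pair (∁ X) (trans (∣∁p∣≡n∸∣p∣ X) (cong₂ _∸_ n≡5 ∣X∣≡3)) =
    p , q , p≢q , trans (sym (∁-involutive X)) (cong ∁ ∁X≡)

  ∉∁pair⁻ : ∀ (p q : Fin n) {t} → t ∉ ∁ (⁅ p ⁆ ∪ ⁅ q ⁆) → t ≡ p ⊎ t ≡ q
  ∉∁pair⁻ p q t∉ = ∈pair⁻ p q (x∉∁p⇒x∈p t∉)

  ∉∁pair₁ : ∀ (p q : Fin n) → p ∉ ∁ (⁅ p ⁆ ∪ ⁅ q ⁆)
  ∉∁pair₁ p q = x∈p⇒x∉∁p (x∈p∪q⁺ (inj₁ (x∈⁅x⁆ p)))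

  ∉∁pair₂ : ∀ (p q : Fin n) → q ∉ ∁ (⁅ p ⁆ ∪ ⁅ q ⁆)
  ∉∁pair₂ p q = x∈p⇒x∉∁p (x∈p∪q⁺ (inj₂ (x∈⁅x⁆ q)))

  ∣co-pair∣≡3 : ∀ p {k} → ¬ k ≈ 0 → ∣ co-pair p k ∣ ≡ 3
  ∣co-pair∣≡3 p {k} k≉0 = trans (∣∁p∣≡n∸∣p∣ (⁅ p ⁆ ∪ ⁅ p ⊕ k ⁆)) (cong₂ _∸_ n≡5 (∣pair∣≡2 p≢p⊕k))
    where
    p≢p⊕k : p ≢ p ⊕ k
    p≢p⊕k e = k≉0 (sym (⊕-cancelˡ p (trans (⊕-identityʳ p) e)))

  co-pairs : ℕ → List (Subset n)
  co-pairs k = map (λ p → co-pair p k) (allFin n)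

  length-co-pairs : ∀ k → length (co-pairs k) ≡ n
  length-co-pairs k = trans (length-map _ (allFin n)) (length-tabulate {n = n} (λ i → i))

  Unique-co-pairs : ∀ {k} → ¬ k + k ≈ 0 → Unique (co-pairs k)
  Unique-co-pairs {k} 2k≉0 = map⁺-Unique _ (Unique.allFin⁺ n) (λ _ _ → injective)
    where
    injective : ∀ {p p'} → co-pair p k ≡ co-pair p' k → p ≡ p'
    injective {p} {p'} e = cases (∉∁pair⁻ p' (p' ⊕ k) (subst (p ∉_) e (∉∁pair₁ p (p ⊕ k))))
                                 (∉∁pair⁻ p (p ⊕ k) (subst (p' ∉_) (sym e) (∉∁pair₁ p' (p' ⊕ k))))
      where
      cases : p ≡ p' ⊎ p ≡ p' ⊕ k → p' ≡ p ⊎ p' ≡ p ⊕ k → p ≡ p'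
      cases (inj₁ p≡p') _ = p≡p'
      cases (inj₂ _) (inj₁ p'≡p) = sym p'≡p
      cases (inj₂ p≡p'+k) (inj₂ p'≡p+k) = ⊥-elim (2k≉0 (sym (⊕-cancelˡ p
        (trans (⊕-identityʳ p) (trans p≡p'+k (trans (cong (_⊕ k) p'≡p+k) (⊕-assoc p k k)))))))

  F₃-Circ≤n : ∀ (a b : Fin n) → ¬ toℕ a ≈ 0 → ¬ toℕ b ≈ 0 → ∀ {k} → IsF 3 (Circ n a b) k → k ≤ n
  F₃-Circ≤n a b a≉0 b≉0 (xs , unique , spec , refl) =
    ≤-trans (Unique-⊆⇒length≤ unique xs⊆) (≤-reflexive (length-co-pairs (toℕ a)))
    where
    A B : ℕ
    A = toℕ a
    B = toℕ b
    arc : ∀ {p q} → StronglyConnectedMinus (Circ n a b) (∁ (⁅ p ⁆ ∪ ⁅ q ⁆)) → p ≢ q → q ≡ p ⊕ A ⊎ q ≡ p ⊕ B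
    arc {p} {q} sc p≢q = Circ-arc⁻ n a b
      (Reach-pair⇒arc _ _ (∉∁pair₁ p q) (λ _ → ∉∁pair⁻ p q) p≢q (sc p q (∉∁pair₁ p q) (∉∁pair₂ p q)) refl)
    xs⊆ : xs ⊆ co-pairs A
    xs⊆ {X} X∈ with ∣X∣≡3 , sc ← Equivalence.to (spec X) X∈
               with p , q , p≢q , refl ← ∣X∣≡3⇒∁pair X ∣X∣≡3
               with arc sc p≢q
    ... | inj₁ refl = ∈-map⁺ (λ v → co-pair v A) (∈-allFin p)
    ... | inj₂ q≡p+b with arc (subst (StronglyConnectedMinus (Circ n a b) ∘ ∁) (∪-comm ⁅ p ⁆ ⁅ q ⁆) sc) (λ e → p≢q (sym e))
    ...   | inj₁ refl = subst (_∈ₗ co-pairs A) (cong ∁ (∪-comm ⁅ q ⁆ ⁅ p ⁆)) (∈-map⁺ (λ v → co-pair v A) (∈-allFin q))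
    ...   | inj₂ p≡q+b = ⊥-elim (b≉0 (x+x≈0⇒x≈0 (cong (_% 2) n≡5) B (sym (⊕-cancelˡ p
            (trans (⊕-identityʳ p) (trans p≡q+b (trans (cong (_⊕ B) q≡p+b) (⊕-assoc p B B))))))))

  n≤F₃-G : ∀ c → 3 * c ≈ 1 → ∀ {k} → IsF 3 (G n c) k → n ≤ k
  n≤F₃-G c 3c≈1 (xs , _ , spec , refl) =
    ≤-trans (≤-reflexive (sym (length-co-pairs 1))) (Unique-⊆⇒length≤ (Unique-co-pairs (≢0⇒≉0 2<n (λ ()))) co-pairs⊆xs)
    where
    open ≡-Reasoning
    2<n : 2 < n
    2<n = subst (2 <_) (sym n≡5) (s≤s (s≤s (s≤s z≤n)))
    -- for n = 5 the arc of length 2c = 2 · 3⁻¹ goes backwards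
    1+2c≈0 : 1 + 2 * c ≈ 0
    1+2c≈0 = begin
      (1 + 2 * c) % n        ≡⟨ +-≈ (sym 3c≈1) refl ⟩
      (3 * c + 2 * c) % n    ≡⟨ cong (_% n) (*-distribʳ-+ c 3 2) ⟨
      (5 * c) % n            ≡⟨ cong (λ m → (m * c) % n) n≡5 ⟨
      (n * c) % n            ≡⟨ cong (_% n) (*-comm n c) ⟩
      (c * n) % n            ≡⟨ m*n%n≡0 c n ⟩
      0                      ≡⟨ m<n⇒m%n≡m 0<n ⟨
      0 % n                  ∎
    sc : ∀ p → StronglyConnectedMinus (G n c) (co-pair p 1)
    sc p u v u∉ v∉ with ∉∁pair⁻ p (p ⊕ 1) u∉ | ∉∁pair⁻ p (p ⊕ 1) v∉
    ... | inj₁ refl | inj₁ refl = here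
    ... | inj₂ refl | inj₂ refl = here
    ... | inj₁ refl | inj₂ refl = step here (G-arc₁ n c p) v∉
    ... | inj₂ refl | inj₁ refl = step here (subst (G n c (p ⊕ 1)) back (G-arc₂ n c (p ⊕ 1))) v∉
      where
      back : p ⊕ 1 ⊕ 2 * c ≡ p
      back = trans (⊕-assoc p 1 (2 * c)) (trans (⊕-cong p 1+2c≈0) (⊕-identityʳ p))
    co-pairs⊆xs : co-pairs 1 ⊆ xs
    co-pairs⊆xs X∈ with p , _ , refl ← ∈-map⁻ (λ v → co-pair v 1) X∈ =
      Equivalence.from (spec _) (∣co-pair∣≡3 p (≢0⇒≉0 (<⇒≤ 2<n) (λ ())) , sc p)

Circ-obstructions : ∀ n {{_ : NonZero n}} → 7 ≤ n → n % 2 ≡ 1 → (a b : Fin n) → a ≢ b →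
  ¬ Modular._≈_ n (toℕ a) 0 → ¬ Modular._≈_ n (toℕ b) 0 → Generates n a b → Obstructions n (Circ n a b)
Circ-obstructions n 7≤n odd a b a≢b a≉0 b≉0 gen with (toℕ a + toℕ b) % n ≟ 0 % n
... | no a+b≉0 = family , Unique-family , (λ X∈ → obstruct (∈-family⁻ X∈)) , length-family
  where
  open NonCycle n (≤-trans (m≤m+n 5 2) 7≤n) odd a b a≢b a≉0 b≉0 a+b≉0
  obstruct : ∀ {X} → ∃[ u ] ∃[ s ] Admissible s × X ≡ φ u s → ∣ X ∣ ≡ 3 × ¬ StronglyConnectedMinus (Circ n a b) X
  obstruct (u , s , adm , refl) = ∣φ∣≡3 u adm , ¬SC-φ u adm
... | yes a+b≈0 = Ψ.family , Ψ.Unique-family , (λ X∈ → obstruct (Ψ.∈-family⁻ X∈)) , Ψ.length-family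
  where
  open Cycle n 7≤n a b a+b≈0 gen
  obstruct : ∀ {X} → ∃[ u ] ∃[ s ] Admissible s × X ≡ ψ u s → ∣ X ∣ ≡ 3 × ¬ StronglyConnectedMinus (Circ n a b) X
  obstruct (u , s , adm , refl) = ∣ψ∣≡3 u adm , ¬SC-ψ u adm

odd-5≤n⇒7≤n : ∀ {n} → 5 ≤ n → n % 2 ≡ 1 → n ≢ 5 → 7 ≤ n
odd-5≤n⇒7≤n 5≤n odd n≢5 = ≤∧≢⇒< (≤∧≢⇒< 5≤n (λ e → n≢5 (sym e))) (λ { refl → 0≢1 odd })
  where
  0≢1 : 0 ≢ 1
  0≢1 ()

mainTheorem8 : (n : ℕ) {{_ : NonZero n}} → 5 ≤ n → n % 2 ≡ 1 → ¬ (3 ∣ n) →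
    (c : ℕ) → (3 * c) % n ≡ 1 →
    (a b : Fin n) → ¬ (a ≡ b) → ¬ (toℕ a ≡ 0) → ¬ (toℕ b ≡ 0) → Generates n a b →
    (kG kH : ℕ) → IsF 3 (Circ n (1 mod n) ((2 * c) mod n)) kG → IsF 3 (Circ n a b) kH →
    kH ≤ kG
mainTheorem8 n 5≤n odd _ c 3c≡1 a b a≢b a≢0 b≢0 gen kG kH F-G F-H = by-cases (n ≟ 5)
  where
  open Modular n
  2<n : 2 < n
  2<n = ≤-trans (m≤m+n 3 2) 5≤n
  3c≈1 : 3 * c ≈ 1
  3c≈1 = trans 3c≡1 (sym (m<n⇒m%n≡m (<⇒≤ 2<n)))
  a≉0 : ¬ toℕ a ≈ 0
  a≉0 = ≢0⇒≉0 (toℕ<n a) a≢0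
  b≉0 : ¬ toℕ b ≈ 0
  b≉0 = ≢0⇒≉0 (toℕ<n b) b≢0
  by-cases : Dec (n ≡ 5) → kH ≤ kG
  by-cases (yes n≡5) = ≤-trans (Five.F₃-Circ≤n n n≡5 a b a≉0 b≉0 F-H) (Five.n≤F₃-G n n≡5 c 3c≈1 F-G)
  by-cases (no n≢5) = obstructions⇒F₃≤F₃-G n 2<n c 3c≈1 F-G F-H
    (Circ-obstructions n (odd-5≤n⇒7≤n 5≤n odd n≢5) odd a b a≢b a≉0 b≉0 gen)
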